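{- Let $t\ge 2$ and let $p=p_1p_2\cdots p_{n-1}$ be a permutation of $\{1,\dots,n-1\}$ that is sorted by the left-greedy algorithm on $t-1$ stacks in series. Then any permutation $p'$ of $\{1,\dots,n\}$ obtained by inserting $n$ into any position of $p$ is sorted by the left-greedy algorithm on $t$ stacks in series.
   Context: Sorting with $s$ stacks in series: the positions, ordered from right to left, are the input, stack $1$, ..., stack $s$, and the output. A permutation starts in the input, whose elements are taken in order from left to right. Legal moves: move the next input element onto the top of stack $1$; for $1\le k<s$ move the top of stack $k$ onto the top of stack $k+1$; move the top of stack $s$ to the output, allowed only if it is the smallest element not yet output. Moves into stacks are legal only if every stack remains increasing from top to bottom (smallest on top). A move is further left than another if its destination is further left. The left-greedy algorithm always performs the leftmost legal move. It fails if not all elements are output and no legal move exists; it sorts the permutation if it outputs all elements (in increasing order) without failing. -}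

module Defs where

open import Data.Nat using (ℕ; zero; suc; _<ᵇ_; _≤ᵇ_)
open import Data.Bool using (Bool; true; false; if_then_else_)
open import Data.List using (List; []; _∷_; _++_; map; upTo; concat; replicate)
open import Data.Bool using (_∧_)
open import Data.Maybe using (Maybe; just; nothing; _>>=_)
open import Data.Product using (_×_; _,_)

oneTo : ℕ → List ℕ
oneTo m = map suc (upTo m)

-- A configuration: the remaining input (read left to right) and the
-- stacks 1,…,s (each as a list, head = top).  The output is not stored:
-- an element is output only when it is the smallest element not yet output,
-- so the output is automatically increasing.
record Config : Set where
  constructor cfg
  field
    input  : List ℕ
    stacks : List (List ℕ)

canPush : ℕ → List ℕ → Bool
canPush x []      = true
canPush x (y ∷ _) = x <ᵇ y

popLast : List (List ℕ) → Maybe (ℕ × List (List ℕ))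
popLast []              = nothing
popLast ((x ∷ a) ∷ [])  = just (x , a ∷ [])
popLast ([] ∷ [])       = nothing
popLast (a ∷ b ∷ rest)  with popLast (b ∷ rest)
... | just (x , r) = just (x , a ∷ r)
... | nothing      = nothing

-- The legal move stack k → stack k+1 with the largest k (the leftmost one),
-- if any such move is legal.
moveInner : List (List ℕ) → Maybe (List (List ℕ))
moveInner []             = nothing
moveInner (a ∷ [])       = nothing
moveInner (a ∷ b ∷ rest) with moveInner (b ∷ rest)
... | just r  = just (a ∷ r)
... | nothing with a
...   | []     = nothing
...   | x ∷ a' = if canPush x b then just (a' ∷ (x ∷ b) ∷ rest) else nothing

moveIn : Config → Maybe Config
moveIn (cfg (x ∷ xs) (a ∷ rest)) =
  if canPush x a then just (cfg xs ((x ∷ a) ∷ rest)) else nothing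
moveIn _ = nothing

allB : (ℕ → Bool) → List ℕ → Bool
allB f []       = true
allB f (y ∷ ys) = f y ∧ allB f ys

-- Output move: top of stack s to the output, legal iff it is the smallest
-- element not yet output (i.e. ≤ every element still in input or stacks).
moveOut : Config → Maybe Config
moveOut (cfg inp sts) with popLast sts
... | nothing       = nothing
... | just (x , r)  =
  if allB (x ≤ᵇ_) (inp ++ concat r) then just (cfg inp r) else nothing

-- One step of the left-greedy algorithm: perform the leftmost legal move
-- (output first, then into stack s, …, then into stack 1);
-- nothing = no legal move.
greedyStep : Config → Maybe Config
greedyStep c with moveOut c
... | just c' = just c'
... | nothing with moveInner (Config.stacks c)
...   | just sts = just (cfg (Config.input c) sts)
...   | nothing  = moveIn c

run : ℕ → Config → Maybe Config
run zero    c = just c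
run (suc k) c = greedyStep c >>= run k

initial : ℕ → List ℕ → Config
initial s p = cfg p (replicate s [])

-- The left-greedy algorithm on s stacks in series sorts p: after finitely
-- many greedy moves every element has been output (input and stacks empty).
-- (Since moves are deterministic, this is exactly "does not fail".)
LGSorts : ℕ → List ℕ → Set
LGSorts s p = Data.Product.∃ λ k → run k (initial s p) ≡ just (cfg [] (replicate s []))
  where open import Relation.Binary.PropositionalEquality using (_≡_)

-- Run the algorithm on p with t − 1 stacks (configuration C) next to the run on p′ with
-- t stacks (configuration D), related by Shadow.  Before n is read, the first stack of D
-- is a buffer holding at most the next input element of C, and the other stacks of D are
-- those of C.  Once read, n lies at the bottom of some stack (buryAt); being the largest
-- element it never changes whether a move of another element is legal, so D keeps
-- replaying the moves of C.  The only moves of D that C does not make are filling the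
-- buffer and moving n one stack to the right (or out); each of them decreases slack, so D
-- catches up with every move of C, and when C has sorted p, D just moves n out.
module Submission where

open import Defs
open import Data.Nat using (ℕ; zero; suc; _+_; _≤_; _<_; _∸_; s≤s; z≤n; _≤ᵇ_; _<ᵇ_)
open import Data.List using (List; []; _∷_; _++_; concat; replicate; length)
open import Data.Maybe using (Maybe; just; nothing; _>>=_; _<∣>_)
import Data.Maybe as Maybe
open import Data.Product using (_×_; _,_; ∃; proj₁; proj₂; map₂)
open import Data.Sum using (_⊎_; inj₁; inj₂)
import Data.Sum as Sum
open import Data.List.Relation.Unary.All using (All; []; _∷_)
open import Data.Bool using (true; false; if_then_else_; _∧_)
open import Data.Bool.Properties using (T-≡; ∧-assoc; ∧-comm)
open import Data.Nat.Properties
  using ( <⇒<ᵇ; <⇒≤; ≤⇒≤ᵇ; ≤-refl; ≤-total; n<1+n; ∸-monoʳ-<; +-monoʳ-<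
        ; m≤n+m; +-suc; m∸n+n≡m)
open import Data.Nat.Induction using (<-wellFounded)
open import Induction.WellFounded using (Acc; acc)
open import Data.List.Relation.Binary.Permutation.Propositional using (_↭_; ↭-sym)
open import Data.List.Relation.Binary.Permutation.Propositional.Properties using (All-resp-↭)
import Data.List.Relation.Unary.All as All
open import Data.List.Relation.Unary.All.Properties using (++⁻ˡ; ++⁻; map⁺; all-upTo; replicate⁺)
open import Data.Maybe.Properties using (map-id)
open import Data.List.Properties using (++-assoc)
open import Function using (_∘_; Equivalence)
open import Relation.Binary.PropositionalEquality
  using (_≡_; refl; sym; trans; cong; cong₂; subst; module ≡-Reasoning)
open import Relation.Binary.Construct.Closure.ReflexiveTransitive using (Star; ε; _◅_; _◅◅_)

open Config using (stacks)

_⟶_ : Config → Config → Set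
C ⟶ C′ = greedyStep C ≡ just C′

_⟶*_ : Config → Config → Set
_⟶*_ = Star _⟶_

run⇒⟶* : ∀ k {C C′} → run k C ≡ just C′ → C ⟶* C′
run⇒⟶* zero refl = ε
run⇒⟶* (suc k) {C} e with greedyStep C in step
... | just C₁ = step ◅ run⇒⟶* k e

⟶*⇒run : ∀ {C C′} → C ⟶* C′ → ∃ λ k → run k C ≡ just C′
⟶*⇒run ε = 0 , refl
⟶*⇒run (step ◅ steps) with ⟶*⇒run steps
... | k , e = suc k , trans (cong (_>>= run k) step) e

popLast-∷ : ∀ a b rest → popLast (a ∷ b ∷ rest) ≡ Maybe.map (map₂ (a ∷_)) (popLast (b ∷ rest))
popLast-∷ []      b rest with popLast (b ∷ rest)
... | just _  = refl
... | nothing = refl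
popLast-∷ (_ ∷ _) b rest with popLast (b ∷ rest)
... | just _  = refl
... | nothing = refl

moveHead : List ℕ → List ℕ → List (List ℕ) → Maybe (List (List ℕ))
moveHead []      b rest = nothing
moveHead (x ∷ a) b rest = if canPush x b then just (a ∷ (x ∷ b) ∷ rest) else nothing

moveInner-∷ : ∀ a b rest →
  moveInner (a ∷ b ∷ rest) ≡ Maybe.map (a ∷_) (moveInner (b ∷ rest)) <∣> moveHead a b rest
moveInner-∷ a b rest with moveInner (b ∷ rest)
moveInner-∷ a       b rest | just _  = refl
moveInner-∷ []      b rest | nothing = refl
moveInner-∷ (_ ∷ _) b rest | nothing = refl

output : List ℕ → ℕ × List (List ℕ) → Maybe Config
output inp (x , r) = if allB (x ≤ᵇ_) (inp ++ concat r) then just (cfg inp r) else nothing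

outputStep : Config → Maybe Config
outputStep (cfg inp sts) = popLast sts >>= output inp

innerStep : Config → Maybe Config
innerStep (cfg inp sts) = Maybe.map (cfg inp) (moveInner sts)

greedyStep-≡ : ∀ c → greedyStep c ≡ outputStep c <∣> innerStep c <∣> moveIn c
greedyStep-≡ (cfg inp sts) with popLast sts
... | just (x , r) with allB (x ≤ᵇ_) (inp ++ concat r)
...   | true  = refl
...   | false with moveInner sts
...     | just _  = refl
...     | nothing = refl
greedyStep-≡ (cfg inp sts) | nothing with moveInner sts
...     | just _  = refl
...     | nothing = refl

stuck-without-stacks : ∀ inp → greedyStep (cfg inp []) ≡ nothing
stuck-without-stacks []      = refl
stuck-without-stacks (_ ∷ _) = refl

popLast-empties : ∀ k → popLast (replicate k []) ≡ nothing
popLast-empties zero          = refl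
popLast-empties (suc zero)    = refl
popLast-empties (suc (suc k)) =
  trans (popLast-∷ [] [] (replicate k [])) (cong (Maybe.map (map₂ ([] ∷_))) (popLast-empties (suc k)))

moveInner-empties : ∀ k → moveInner (replicate k []) ≡ nothing
moveInner-empties zero          = refl
moveInner-empties (suc zero)    = refl
moveInner-empties (suc (suc k)) =
  trans (moveInner-∷ [] [] (replicate k []))
        (cong (λ m → Maybe.map ([] ∷_) m <∣> nothing) (moveInner-empties (suc k)))

greedyStep-[]∷ : ∀ E →
  greedyStep (cfg [] ([] ∷ E)) ≡ Maybe.map (cfg [] ∘ ([] ∷_) ∘ stacks) (greedyStep (cfg [] E))
greedyStep-[]∷ [] = refl
greedyStep-[]∷ (b ∷ rest)
  rewrite greedyStep-≡ (cfg [] ([] ∷ b ∷ rest)) | greedyStep-≡ (cfg [] (b ∷ rest))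
        | popLast-∷ [] b rest | moveInner-∷ [] b rest
  with popLast (b ∷ rest) | moveInner (b ∷ rest)
... | nothing      | nothing = refl
... | nothing      | just _  = refl
... | just (y , r) | inner with allB (y ≤ᵇ_) (concat r)
...   | true = refl
...   | false with inner
...     | nothing = refl
...     | just _  = refl

reads-into-empties : ∀ x inp k →
  cfg (x ∷ inp) (replicate (suc k) []) ⟶ cfg inp ((x ∷ []) ∷ replicate k [])
reads-into-empties x inp k
  rewrite greedyStep-≡ (cfg (x ∷ inp) (replicate (suc k) []))
        | popLast-empties (suc k) | moveInner-empties (suc k) = refl

<∣>-just : ∀ {A : Set} (mx my : Maybe A) {z} → (mx <∣> my) ≡ just z → mx ≡ just z ⊎ my ≡ just z
<∣>-just (just _) my e = inj₁ e
<∣>-just nothing  my e = inj₂ e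

AllElems : (ℕ → Set) → Config → Set
AllElems P (cfg inp sts) = All P inp × All (All P) sts

module _ {P : ℕ → Set} where

  popLast-All : ∀ {sts y r} → All (All P) sts → popLast sts ≡ just (y , r) → P y × All (All P) r
  popLast-All {(x ∷ a) ∷ []} ((px ∷ pa) ∷ []) refl = px , pa ∷ []
  popLast-All {a ∷ b ∷ rest} (pa ∷ ps) e
    rewrite popLast-∷ a b rest with popLast (b ∷ rest) in eq
  ... | just (y , r) with refl ← e = map₂ (pa ∷_) (popLast-All ps eq)

  moveHead-All : ∀ {a b rest sts} → All (All P) (a ∷ b ∷ rest) →
    moveHead a b rest ≡ just sts → All (All P) sts
  moveHead-All {x ∷ a} {b} ((px ∷ pa) ∷ pb ∷ prest) e with canPush x b
  ... | true with refl ← e = pa ∷ (px ∷ pb) ∷ prest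

  moveInner-All : ∀ {sts sts′} → All (All P) sts → moveInner sts ≡ just sts′ → All (All P) sts′
  moveInner-All {a ∷ b ∷ rest} (pa ∷ ps) e
    rewrite moveInner-∷ a b rest with moveInner (b ∷ rest) in eq
  ... | just r with refl ← e = pa ∷ moveInner-All ps eq
  ... | nothing = moveHead-All (pa ∷ ps) e

  outputStep-All : ∀ {C C′} → AllElems P C → outputStep C ≡ just C′ → AllElems P C′
  outputStep-All {cfg inp sts} (pi , ps) e with popLast sts in eq
  ... | just (y , r) with allB (y ≤ᵇ_) (inp ++ concat r)
  ...   | true with refl ← e = pi , proj₂ (popLast-All ps eq)

  moveIn-All : ∀ {C C′} → AllElems P C → moveIn C ≡ just C′ → AllElems P C′
  moveIn-All {cfg (x ∷ inp) (a ∷ rest)} (px ∷ pi , pa ∷ prest) e with canPush x a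
  ... | true with refl ← e = pi , (px ∷ pa) ∷ prest

  greedyStep-All : ∀ {C C′} → AllElems P C → C ⟶ C′ → AllElems P C′
  greedyStep-All {C@(cfg inp sts)} (pi , ps) step
    rewrite greedyStep-≡ C with <∣>-just (outputStep C) _ step
  ... | inj₁ out = outputStep-All (pi , ps) out
  ... | inj₂ step′ with <∣>-just (innerStep C) _ step′
  ...   | inj₂ into = moveIn-All (pi , ps) into
  ...   | inj₁ inner with moveInner sts in eq
  ...     | just sts′ with refl ← inner = pi , moveInner-All ps eq

<⇒<ᵇ≡true : ∀ {x y} → x < y → (x <ᵇ y) ≡ true
<⇒<ᵇ≡true = Equivalence.to T-≡ ∘ <⇒<ᵇ

<⇒≤ᵇ≡true : ∀ {x y} → x < y → (x ≤ᵇ y) ≡ true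
<⇒≤ᵇ≡true = Equivalence.to T-≡ ∘ ≤⇒≤ᵇ ∘ <⇒≤

map-nothing⁻ : ∀ {A B : Set} {f : A → B} m → Maybe.map f m ≡ nothing → m ≡ nothing
map-nothing⁻ nothing _ = refl

≤⇒<ᵇ≡false : ∀ {x y} → y ≤ x → (x <ᵇ y) ≡ false
≤⇒<ᵇ≡false {x} {zero}  _         = refl
≤⇒<ᵇ≡false {suc x} {suc y} (s≤s y≤x) = ≤⇒<ᵇ≡false y≤x

allB-++ : ∀ f xs ys → allB f (xs ++ ys) ≡ allB f xs ∧ allB f ys
allB-++ f []       ys = refl
allB-++ f (x ∷ xs) ys = trans (cong (f x ∧_) (allB-++ f xs ys)) (sym (∧-assoc (f x) _ _))

allB-prefix : ∀ f xs {l l′} → allB f l ≡ allB f l′ → allB f (xs ++ l) ≡ allB f (xs ++ l′)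
allB-prefix f []       e = e
allB-prefix f (x ∷ xs) e = cong (f x ∧_) (allB-prefix f xs e)

data Buffer : List ℕ → Set where
  empty   : Buffer []
  holding : ∀ x → Buffer (x ∷ [])

module _ (n : ℕ) where

  -- n at the bottom of stack j (counted from 0); for j ≥ length E nothing is buried,
  -- which models n having been output.
  buryAt : ℕ → List (List ℕ) → List (List ℕ)
  buryAt _       []      = []
  buryAt zero    (a ∷ E) = (a ++ n ∷ []) ∷ E
  buryAt (suc j) (a ∷ E) = a ∷ buryAt j E

  bury : Maybe ℕ → List (List ℕ) → List (List ℕ)
  bury nothing  E = E
  bury (just j) E = buryAt j E

  popLast-∷-buryAt : ∀ a j b rest →
    popLast (a ∷ buryAt j (b ∷ rest)) ≡ Maybe.map (map₂ (a ∷_)) (popLast (buryAt j (b ∷ rest)))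
  popLast-∷-buryAt a zero    b rest = popLast-∷ a _ _
  popLast-∷-buryAt a (suc j) b rest = popLast-∷ a _ _

  popLast-buryAt : ∀ j E →
    popLast (buryAt j E) ≡ Maybe.map (map₂ (buryAt j)) (popLast E)
    ⊎ j < length E × popLast E ≡ nothing × popLast (buryAt j E) ≡ just (n , buryAt (suc j) E)
  popLast-buryAt j       [] = inj₁ refl
  popLast-buryAt zero    ([] ∷ []) = inj₂ (s≤s z≤n , refl , refl)
  popLast-buryAt zero    ((x ∷ a) ∷ []) = inj₁ refl
  popLast-buryAt (suc j) ([] ∷ []) = inj₁ refl
  popLast-buryAt (suc j) ((x ∷ a) ∷ []) = inj₁ refl
  popLast-buryAt zero    (a ∷ b ∷ rest)
    rewrite popLast-∷ (a ++ n ∷ []) b rest | popLast-∷ a b rest with popLast (b ∷ rest)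
  ... | just _  = inj₁ refl
  ... | nothing = inj₁ refl
  popLast-buryAt (suc j) (a ∷ b ∷ rest)
    rewrite popLast-∷-buryAt a j b rest | popLast-∷ a b rest with popLast-buryAt j (b ∷ rest)
  ... | inj₁ commutes rewrite commutes with popLast (b ∷ rest)
  ...   | just _  = inj₁ refl
  ...   | nothing = inj₁ refl
  popLast-buryAt (suc j) (a ∷ b ∷ rest) | inj₂ (j< , none , out) rewrite none | out =
    inj₂ (s≤s j< , refl , refl)

  canPush-++n : ∀ {x} b → x < n → canPush x (b ++ n ∷ []) ≡ canPush x b
  canPush-++n []      x<n = <⇒<ᵇ≡true x<n
  canPush-++n (_ ∷ _) _   = refl

  moveHead-onto-buried : ∀ a b rest → All (_< n) a →
    moveHead a (b ++ n ∷ []) rest ≡ Maybe.map (buryAt 1) (moveHead a b rest)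
  moveHead-onto-buried []      b rest _ = refl
  moveHead-onto-buried (x ∷ a) b rest (x<n ∷ _) rewrite canPush-++n b x<n with canPush x b
  ... | true  = refl
  ... | false = refl

  moveHead-above-buried : ∀ j a b rest →
    moveHead a b (buryAt j rest) ≡ Maybe.map (buryAt (2 + j)) (moveHead a b rest)
  moveHead-above-buried j []      b rest = refl
  moveHead-above-buried j (x ∷ a) b rest with canPush x b
  ... | true  = refl
  ... | false = refl

  moveInner-buryAt : ∀ j E → All (All (_< n)) E →
    moveInner (buryAt j E) ≡ Maybe.map (buryAt j) (moveInner E)
    ⊎ j < length E × moveInner (buryAt j E) ≡ just (buryAt (suc j) E)
  moveInner-buryAt j       []      _ = inj₁ refl
  moveInner-buryAt zero    (a ∷ []) _ = inj₁ refl
  moveInner-buryAt (suc j) (a ∷ []) _ = inj₁ refl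
  moveInner-buryAt zero (a ∷ b ∷ rest) (_ ∷ b<n ∷ _)
    rewrite moveInner-∷ (a ++ n ∷ []) b rest | moveInner-∷ a b rest with moveInner (b ∷ rest)
  ... | just _ = inj₁ refl
  ... | nothing with a | b | b<n
  ...   | []    | []    | _ = inj₂ (s≤s z≤n , refl)
  ...   | []    | y ∷ _ | y<n ∷ _ rewrite ≤⇒<ᵇ≡false (<⇒≤ y<n) = inj₁ refl
  ...   | x ∷ _ | b′    | _ with canPush x b′
  ...     | true  = inj₁ refl
  ...     | false = inj₁ refl
  moveInner-buryAt (suc zero) (a ∷ b ∷ rest) (a<n ∷ E<n)
    rewrite moveInner-∷ a (b ++ n ∷ []) rest | moveInner-∷ a b rest
    with moveInner-buryAt zero (b ∷ rest) E<n
  ... | inj₂ (j< , advance) rewrite advance = inj₂ (s≤s j< , refl)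
  ... | inj₁ commutes rewrite commutes | moveHead-onto-buried a b rest a<n with moveInner (b ∷ rest)
  ...   | just _  = inj₁ refl
  ...   | nothing = inj₁ refl
  moveInner-buryAt (suc (suc j)) (a ∷ b ∷ rest) (_ ∷ E<n)
    rewrite moveInner-∷ a b (buryAt j rest) | moveInner-∷ a b rest
    with moveInner-buryAt (suc j) (b ∷ rest) E<n
  ... | inj₂ (j< , advance) rewrite advance = inj₂ (s≤s j< , refl)
  ... | inj₁ commutes rewrite commutes | moveHead-above-buried j a b rest with moveInner (b ∷ rest)
  ...   | just _  = inj₁ refl
  ...   | nothing = inj₁ refl

  popLast-bury : ∀ jm E →
    popLast (bury jm E) ≡ Maybe.map (map₂ (bury jm)) (popLast E)
    ⊎ ∃ λ j → jm ≡ just j × j < length E × popLast E ≡ nothing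
              × popLast (bury jm E) ≡ just (n , buryAt (suc j) E)
  popLast-bury nothing  E = inj₁ (sym (map-id (popLast E)))
  popLast-bury (just j) E = Sum.map₂ (λ advance → j , refl , advance) (popLast-buryAt j E)

  moveInner-bury : ∀ jm E → All (All (_< n)) E →
    moveInner (bury jm E) ≡ Maybe.map (bury jm) (moveInner E)
    ⊎ ∃ λ j → jm ≡ just j × j < length E × moveInner (bury jm E) ≡ just (buryAt (suc j) E)
  moveInner-bury nothing  E _   = inj₁ (sym (map-id (moveInner E)))
  moveInner-bury (just j) E E<n = Sum.map₂ (λ advance → j , refl , advance) (moveInner-buryAt j E E<n)

  allB-insert : ∀ f → f n ≡ true → ∀ xs ys → allB f (xs ++ n ∷ ys) ≡ allB f (xs ++ ys)
  allB-insert f fn xs ys = allB-prefix f xs (cong (_∧ allB f ys) fn)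

  allB-concat-buryAt : ∀ f → f n ≡ true → ∀ j E → allB f (concat (buryAt j E)) ≡ allB f (concat E)
  allB-concat-buryAt f fn j       []      = refl
  allB-concat-buryAt f fn zero    (a ∷ E) =
    trans (cong (allB f) (++-assoc a (n ∷ []) (concat E))) (allB-insert f fn a (concat E))
  allB-concat-buryAt f fn (suc j) (a ∷ E) = allB-prefix f a (allB-concat-buryAt f fn j E)

  allB-concat-bury : ∀ f → f n ≡ true → ∀ jm E → allB f (concat (bury jm E)) ≡ allB f (concat E)
  allB-concat-bury f fn nothing  E = refl
  allB-concat-bury f fn (just j) E = allB-concat-buryAt f fn j E

  -- l and l′ differ at most in copies of n, as far as output tests can tell.
  record Agree (l l′ : List ℕ) : Set where
    constructor agreeing
    field allB-agrees : ∀ f → f n ≡ true → allB f l ≡ allB f l′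

  agree-contents : ∀ {iD iC} → Agree iD iC → ∀ jm h r →
    Agree (iD ++ concat (bury jm (h ∷ r))) ((h ++ iC) ++ concat r)
  agree-contents {iD} {iC} (agreeing agree) jm h r = agreeing λ f fn → begin
    allB f (iD ++ concat (bury jm (h ∷ r)))
      ≡⟨ allB-++ f iD _ ⟩
    allB f iD ∧ allB f (concat (bury jm (h ∷ r)))
      ≡⟨ cong₂ _∧_ (agree f fn) (allB-concat-bury f fn jm (h ∷ r)) ⟩
    allB f iC ∧ allB f (h ++ concat r)
      ≡⟨ cong (allB f iC ∧_) (allB-++ f h (concat r)) ⟩
    allB f iC ∧ (allB f h ∧ allB f (concat r))
      ≡⟨ sym (∧-assoc (allB f iC) _ _) ⟩
    (allB f iC ∧ allB f h) ∧ allB f (concat r)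
      ≡⟨ cong (_∧ allB f (concat r)) (∧-comm (allB f iC) _) ⟩
    (allB f h ∧ allB f iC) ∧ allB f (concat r)
      ≡⟨ cong (_∧ allB f (concat r)) (sym (allB-++ f h iC)) ⟩
    allB f (h ++ iC) ∧ allB f (concat r)
      ≡⟨ sym (allB-++ f (h ++ iC) (concat r)) ⟩
    allB f ((h ++ iC) ++ concat r)
      ∎
    where open ≡-Reasoning

  agree-refl : ∀ {l} → Agree l l
  agree-refl = agreeing λ _ _ → refl

  agree-insert : ∀ xs ys → Agree (xs ++ n ∷ ys) (xs ++ ys)
  agree-insert xs ys = agreeing λ f fn → allB-insert f fn xs ys

  -- base h E and extended h E are the configurations C and D of a Shadow pair, with buffer h.
  module OneStep {iD iC : List ℕ} (agree : Agree iD iC) (jm : Maybe ℕ) where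

    base : List ℕ → List (List ℕ) → Config
    base h E = cfg (h ++ iC) E

    extended : List ℕ → List (List ℕ) → Config
    extended h E = cfg iD (bury jm (h ∷ E))

    data OutputCase (h : List ℕ) (E : List (List ℕ)) : Maybe Config → Maybe Config → Set where
      both-output : ∀ {r} → OutputCase h E (just (base h r)) (just (extended h r))
      n-output    : ∀ {j oC} → jm ≡ just j → j < length (h ∷ E) →
                    OutputCase h E oC (just (cfg iD (buryAt (suc j) (h ∷ E))))
      no-output   : OutputCase h E nothing nothing

    output-case : ∀ h b S → All (All (_< n)) (b ∷ S) →
      OutputCase h (b ∷ S) (outputStep (base h (b ∷ S))) (outputStep (extended h (b ∷ S)))
    output-case h b S E<n with popLast-bury jm (h ∷ b ∷ S)
    ... | inj₁ commutes rewrite commutes | popLast-∷ h b S with popLast (b ∷ S) in eq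
    ...   | nothing = no-output
    ...   | just (y , r)
      with allB (y ≤ᵇ_) (iD ++ concat (bury jm (h ∷ r))) | allB (y ≤ᵇ_) ((h ++ iC) ++ concat r)
         | Agree.allB-agrees (agree-contents agree jm h r) (y ≤ᵇ_)
                             (<⇒≤ᵇ≡true (proj₁ (popLast-All E<n eq)))
    ...     | test | .test | refl with test
    ...       | true  = both-output
    ...       | false = no-output
    output-case h b S E<n | inj₂ (j , refl , j< , none , out)
      rewrite out | map-nothing⁻ (popLast (b ∷ S)) (trans (sym (popLast-∷ h b S)) none)
      with allB (n ≤ᵇ_) (iD ++ concat (buryAt (suc j) (h ∷ b ∷ S)))
    ... | true  = n-output refl j<
    ... | false = no-output

    data StepCase : List ℕ → List (List ℕ) → Maybe Config → Maybe Config → Set where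
      lockstep   : ∀ {h E h′ E′} → Buffer h′ →
                   StepCase h E (just (base h′ E′)) (just (extended h′ E′))
      n-advances : ∀ {h E j oC} → jm ≡ just j → j < length (h ∷ E) →
                   StepCase h E oC (just (cfg iD (buryAt (suc j) (h ∷ E))))
      both-read  : ∀ {E} → StepCase [] E (moveIn (base [] E)) (moveIn (extended [] E))
      stuck      : ∀ {h E oD} → StepCase h E nothing oD

    step-case : ∀ {h} → Buffer h → ∀ b S → All (All (_< n)) (h ∷ b ∷ S) →
      StepCase h (b ∷ S) (greedyStep (base h (b ∷ S))) (greedyStep (extended h (b ∷ S)))
    step-case {h} buf b S (h<n ∷ E<n)
      rewrite greedyStep-≡ (base h (b ∷ S)) | greedyStep-≡ (extended h (b ∷ S))
      with outputStep (base h (b ∷ S)) | outputStep (extended h (b ∷ S)) | output-case h b S E<n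
    ... | _ | _ | both-output      = lockstep buf
    ... | _ | _ | n-output refl j< = n-advances refl j<
    ... | _ | _ | no-output with moveInner-bury jm (h ∷ b ∷ S) (h<n ∷ E<n)
    ...   | inj₂ (j , refl , j< , advance) rewrite advance = n-advances refl j<
    ...   | inj₁ commutes rewrite commutes | moveInner-∷ h b S with moveInner (b ∷ S)
    ...     | just r = lockstep buf
    ...     | nothing with buf
    ...       | empty = both-read
    ...       | holding x with canPush x b
    ...         | true  = lockstep empty
    ...         | false = stuck

  data Shadow : Config → Config → Set where
    before : ∀ {h} → Buffer h → ∀ xs ys S →
             Shadow (cfg (h ++ xs ++ ys) S) (cfg (xs ++ n ∷ ys) (h ∷ S))
    after  : ∀ {h} → Buffer h → ∀ j inp S →
             Shadow (cfg (h ++ inp) S) (cfg inp (buryAt j (h ∷ S)))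

  bufferSlack : ∀ {h} → Buffer h → ℕ
  bufferSlack empty       = 1
  bufferSlack (holding _) = 0

  -- Filling the buffer lowers the first summand; reading n or moving it right, the second.
  slack : ∀ {C D} → Shadow C D → ℕ
  slack (before buf xs ys S) = bufferSlack buf + (2 + length S)
  slack (after {h} buf j inp S) = bufferSlack buf + (length (h ∷ S) ∸ j)

  data Progress {C D} (r : Shadow C D) (C′ : Config) : Set where
    follows  : ∀ {D′} → D ⟶ D′ → Shadow C′ D′ → Progress r C′
    stutters : ∀ {D′} → D ⟶ D′ → (r′ : Shadow C D′) → slack r′ < slack r → Progress r C′

  open OneStep

  progress-before : ∀ {h C′} (buf : Buffer h) xs ys b S →
    ∀ {oC oD} → StepCase (agree-insert xs ys) nothing h (b ∷ S) oC oD →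
    oC ≡ just C′ → greedyStep (cfg (xs ++ n ∷ ys) (h ∷ b ∷ S)) ≡ oD →
    Progress (before buf xs ys (b ∷ S)) C′
  progress-before buf xs ys b S (lockstep buf′) refl eD = follows eD (before buf′ xs ys _)
  progress-before buf xs ys b S (n-advances () _) _ _
  progress-before {.[]} empty xs ys b S both-read _ eD = read-before xs eD
    where
    read-before : ∀ xs {C′} → let D = cfg (xs ++ n ∷ ys) ([] ∷ b ∷ S) in
      greedyStep D ≡ moveIn D → Progress (before empty xs ys (b ∷ S)) C′
    read-before (x ∷ xs) eD = stutters eD (before (holding x) xs ys (b ∷ S)) ≤-refl
    read-before []       eD = stutters eD (after empty 0 ys (b ∷ S)) ≤-refl
  progress-before buf xs ys b S stuck () _

  moveIn-onto-buried : ∀ j {x} inp E → x < n →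
    moveIn (cfg (x ∷ inp) (buryAt j ([] ∷ E))) ≡ just (cfg inp (buryAt j ((x ∷ []) ∷ E)))
  moveIn-onto-buried zero    inp E x<n rewrite <⇒<ᵇ≡true x<n = refl
  moveIn-onto-buried (suc j) inp E _   = refl

  progress-after : ∀ {h C′} (buf : Buffer h) j inp b S → All (_< n) inp →
    ∀ {oC oD} → StepCase (agree-refl {inp}) (just j) h (b ∷ S) oC oD →
    oC ≡ just C′ → greedyStep (cfg inp (buryAt j (h ∷ b ∷ S))) ≡ oD →
    Progress (after buf j inp (b ∷ S)) C′
  progress-after buf j inp b S _ (lockstep buf′) refl eD = follows eD (after buf′ j inp _)
  progress-after buf j inp b S _ (n-advances refl j<) _ eD =
    stutters eD (after buf (suc j) inp (b ∷ S)) (+-monoʳ-< (bufferSlack buf) (∸-monoʳ-< (n<1+n j) j<))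
  progress-after {.[]} empty j inp b S inp<n both-read eC eD = read-after inp inp<n eC eD
    where
    read-after : ∀ inp {C′} → All (_< n) inp → moveIn (cfg inp (b ∷ S)) ≡ just C′ →
      greedyStep (cfg inp (buryAt j ([] ∷ b ∷ S))) ≡ moveIn (cfg inp (buryAt j ([] ∷ b ∷ S))) →
      Progress (after empty j inp (b ∷ S)) C′
    read-after (x ∷ inp) (x<n ∷ _) _ eD =
      stutters (trans eD (moveIn-onto-buried j inp (b ∷ S) x<n)) (after (holding x) j inp (b ∷ S)) ≤-refl
    read-after [] _ () _
  progress-after buf j inp b S _ stuck () _

  progress : ∀ {C D C′} (r : Shadow C D) → AllElems (_< n) C → C ⟶ C′ → Progress r C′
  progress (before {h} buf xs ys []) _ step with () ← trans (sym (stuck-without-stacks (h ++ xs ++ ys))) step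
  progress (before {h} buf xs ys (b ∷ S)) (i<n , E<n) step =
    progress-before buf xs ys b S
      (step-case (agree-insert xs ys) nothing buf b S (++⁻ˡ h i<n ∷ E<n)) step refl
  progress (after {h} buf j inp []) _ step with () ← trans (sym (stuck-without-stacks (h ++ inp))) step
  progress (after {h} buf j inp (b ∷ S)) (i<n , E<n) step =
    progress-after buf j inp b S (proj₂ (++⁻ h i<n))
      (step-case agree-refl (just j) buf b S (proj₁ (++⁻ h i<n) ∷ E<n)) step refl

  simulate : ∀ {C D C′} (r : Shadow C D) → Acc _<_ (slack r) → AllElems (_< n) C → C ⟶ C′ →
    ∃ λ D′ → D ⟶* D′ × Shadow C′ D′
  simulate r (acc smaller) C<n step with progress r C<n step
  ... | follows stepD r′ = _ , stepD ◅ ε , r′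
  ... | stutters stepD r′ r′<r with simulate r′ (smaller r′<r) C<n step
  ...   | D′ , steps , r″ = D′ , stepD ◅ steps , r″

  sink-step : ∀ {j k} → j < k →
    cfg [] (buryAt j (replicate k [])) ⟶ cfg [] (buryAt (suc j) (replicate k []))
  sink-step {zero} {suc zero} _ = refl
  sink-step {zero} {suc (suc k)} _
    rewrite greedyStep-≡ (cfg [] ((n ∷ []) ∷ [] ∷ replicate k []))
          | popLast-∷ (n ∷ []) [] (replicate k []) | popLast-empties (suc k)
          | moveInner-∷ (n ∷ []) [] (replicate k []) | moveInner-empties (suc k) = refl
  sink-step {suc j} {suc k} (s≤s j<k) =
    trans (greedyStep-[]∷ (buryAt j (replicate k []))) (cong (Maybe.map _) (sink-step j<k))

  buryAt-beyond : ∀ {j k} → k ≤ j → buryAt j (replicate k []) ≡ replicate k []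
  buryAt-beyond {k = zero}          _         = refl
  buryAt-beyond {suc j} {suc k} (s≤s k≤j) = cong ([] ∷_) (buryAt-beyond k≤j)

  NExits : ℕ → ℕ → Set
  NExits j k = cfg [] (buryAt j (replicate k [])) ⟶* cfg [] (replicate k [])

  n-exits-within : ∀ i j → NExits j (i + j)
  n-exits-within zero    j rewrite buryAt-beyond (≤-refl {j}) = ε
  n-exits-within (suc i) j =
    sink-step (s≤s (m≤n+m j i)) ◅ subst (NExits (suc j)) (+-suc i j) (n-exits-within i (suc j))

  n-exits : ∀ j k → NExits j k
  n-exits j k with ≤-total j k
  ... | inj₁ j≤k = subst (NExits j) (m∸n+n≡m j≤k) (n-exits-within (k ∸ j) j)
  ... | inj₂ k≤j rewrite buryAt-beyond k≤j = ε

  finish : ∀ {C D s} → Shadow C D → C ≡ cfg [] (replicate s []) → D ⟶* cfg [] (replicate (suc s) [])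
  finish {s = s} (before empty [] [] _) refl = reads-into-empties n [] s ◅ n-exits 0 (suc s)
  finish {s = s} (after empty j [] _)   refl = n-exits j (suc s)
  finish (before (holding _) _ _ _)     ()
  finish (before empty (_ ∷ _) _ _)     ()
  finish (before empty [] (_ ∷ _) _)    ()
  finish (after (holding _) _ _ _)      ()
  finish (after empty _ (_ ∷ _) _)      ()

  shadow-sorts : ∀ {C D s} → Shadow C D → AllElems (_< n) C →
    C ⟶* cfg [] (replicate s []) → D ⟶* cfg [] (replicate (suc s) [])
  shadow-sorts r C<n ε = finish r refl
  shadow-sorts r C<n (step ◅ steps) with simulate r (<-wellFounded _) C<n step
  ... | D′ , stepsD , r′ = stepsD ◅◅ shadow-sorts r′ (greedyStep-All C<n step) steps

lemma3p1 : (t m : ℕ) → 2 ≤ t → (p : List ℕ) → p ↭ oneTo m →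
    LGSorts (t ∸ 1) p →
    (xs ys : List ℕ) → p ≡ xs ++ ys →
    LGSorts t (xs ++ suc m ∷ ys)
lemma3p1 (suc (suc s)) m (s≤s (s≤s z≤n)) p p↭ (k , sorted) xs ys refl =
  ⟶*⇒run (shadow-sorts (suc m) (before empty xs ys (replicate (suc s) [])) (p<n , replicate⁺ (suc s) [])
    (run⇒⟶* k sorted))
  where
  p<n : All (_< suc m) p
  p<n = All-resp-↭ (↭-sym p↭) (map⁺ (All.map s≤s (all-upTo m)))
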